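{- For every integer $k > 1$, $U_{3k,\,k-1} = U_{3k,\,k+1}$.
   Context: A Motzkin word of length $n$ is a string over the alphabet $\{0, (, )\}$ in which the numbers of left and right parentheses are equal and in every prefix the number of left parentheses is at least the number of right parentheses. The parentheses of such a word decompose uniquely into matched pairs. For $n\ge 1$ and $j\ge 1$, $U_{n,j}$ denotes the number of Motzkin words of length $n$ that begin with a left parenthesis and contain exactly $j$ matched pairs of parentheses (i.e. exactly $j$ left parentheses). -}

module Defs where

open import Data.Nat using (ℕ; zero; suc; _≡ᵇ_)
open import Data.Bool using (Bool; true; false; _∧_)
open import Data.List using (List; []; _∷_; length; filter; concatMap)
open import Data.Maybe using (Maybe; just; nothing)
open import Relation.Nullary.Decidable using (Dec)
open import Data.Bool using (T; T?)
open import Relation.Unary using (Pred; Decidable)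
open import Level using (0ℓ)

-- The alphabet {0, (, )}.
data Letter : Set where
  O  : Letter
  Lp : Letter
  Rp : Letter

Word : Set
Word = List Letter

height : ℕ → Word → Maybe ℕ
height h []        = just h
height h (O  ∷ w)  = height h w
height h (Lp ∷ w)  = height (suc h) w
height zero    (Rp ∷ w) = nothing
height (suc h) (Rp ∷ w) = height h w

isMotzkin : Word → Bool
isMotzkin w with height 0 w
... | just zero = true
... | _         = false

startsWithLeft : Word → Bool
startsWithLeft (Lp ∷ _) = true
startsWithLeft _        = false

-- number of left parentheses (= number of matched pairs in a Motzkin word)
numLeft : Word → ℕ
numLeft []        = 0
numLeft (Lp ∷ w)  = suc (numLeft w)
numLeft (_  ∷ w)  = numLeft w

allWords : ℕ → List Word
allWords zero    = [] ∷ []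
allWords (suc n) = concatMap (λ w → (O ∷ w) ∷ (Lp ∷ w) ∷ (Rp ∷ w) ∷ []) (allWords n)

isU : ℕ → Word → Bool
isU j w = isMotzkin w ∧ startsWithLeft w ∧ (numLeft w ≡ᵇ j)

U : ℕ → ℕ → ℕ
U n j = length (filter (λ w → T? (isU j w)) (allWords n))

-- A word counted by U (n + 1) (j + 1) is '(' followed by a word w that, read from height 1,
-- never drops below 0, ends at 0 and has j left parentheses.  Let M m h j count such words w of
-- length m read from height h; they have j + h right parentheses and z = m − 2j − h zeros.
-- Splitting on the first letter gives a three-term recurrence, and induction on m shows that
-- M m h j is the ballot number (h + 1) / (j + h + 1) · m! / (z! j! (j + h)!).  For m = 3k − 1 and
-- h = 1, the cases j = k − 2 (z = k + 2) and j = k (z = k − 2) have the same factorials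
-- (k + 2)!, (k − 2)!, k! in the denominator, hence the same count.
module Submission where

open import Defs
open import Data.Nat using (ℕ; suc; _*_; _<_; _∸_)
open import Relation.Binary.PropositionalEquality using (_≡_)

open import Data.Bool using (Bool; true; false; if_then_else_; _∧_; T?)
open import Data.Bool.Properties using (∧-zeroʳ)
open import Data.List using (List; []; _∷_; length; filter; concatMap)
open import Data.Maybe using (Maybe; just; nothing; maybe′)
open import Data.Nat using (zero; _+_; _!; _≡ᵇ_; NonZero; s≤s; s≤s⁻¹)
open import Data.Nat.Properties
  using (+-suc; +-comm; +-identityʳ; suc-injective; *-cancelʳ-≡; m*n≢0; _!≢0; _!*_!≢0; *-commutativeSemigroup;
         ≤-reflexive; <-trans; n<1+n)
open import Algebra.Properties.CommutativeSemigroup *-commutativeSemigroup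
  using (x∙yz≈y∙xz; xy∙z≈yz∙x)
open import Data.Nat.Tactic.RingSolver using (solve-∀)
open import Function using (_∘_)
open import Relation.Binary.PropositionalEquality
  using (refl; sym; trans; cong; cong₂; subst; module ≡-Reasoning)
open ≡-Reasoning

count : {A : Set} → (A → Bool) → List A → ℕ
count p xs = length (filter (λ x → T? (p x)) xs)

count-∷ : {A : Set} (p : A → Bool) (x : A) (xs : List A) →
          count p (x ∷ xs) ≡ (if p x then 1 else 0) + count p xs
count-∷ p x xs with p x
... | true  = refl
... | false = refl

count-cong : {A : Set} {p q : A → Bool} → (∀ x → p x ≡ q x) → ∀ xs → count p xs ≡ count q xs
count-cong p≗q []       = refl
count-cong {p = p} {q} p≗q (x ∷ xs) = begin
  count p (x ∷ xs)                            ≡⟨ count-∷ p x xs ⟩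
  (if p x then 1 else 0) + count p xs         ≡⟨ cong₂ _+_ (cong (if_then 1 else 0) (p≗q x)) (count-cong p≗q xs) ⟩
  (if q x then 1 else 0) + count q xs         ≡⟨ sym (count-∷ q x xs) ⟩
  count q (x ∷ xs)                            ∎

count-false : {A : Set} {p : A → Bool} → (∀ x → p x ≡ false) → ∀ xs → count p xs ≡ 0
count-false p≗false []       = refl
count-false {p = p} p≗false (x ∷ xs) =
  trans (count-∷ p x xs) (cong₂ _+_ (cong (if_then 1 else 0) (p≗false x)) (count-false p≗false xs))

extend : Word → List Word
extend w = (O ∷ w) ∷ (Lp ∷ w) ∷ (Rp ∷ w) ∷ []

count-concatMap-extend : ∀ (p : Word → Bool) ws →
  count p (concatMap extend ws) ≡ count (p ∘ (O ∷_)) ws + count (p ∘ (Lp ∷_)) ws + count (p ∘ (Rp ∷_)) ws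
count-concatMap-extend p []       = refl
count-concatMap-extend p (w ∷ ws) = begin
  count p (concatMap extend (w ∷ ws))
    ≡⟨ trans (count-∷ p _ _) (cong (bit O +_) (trans (count-∷ p _ _) (cong (bit Lp +_) (count-∷ p _ _)))) ⟩
  bit O + (bit Lp + (bit Rp + count p (concatMap extend ws)))
    ≡⟨ cong (λ t → bit O + (bit Lp + (bit Rp + t))) (count-concatMap-extend p ws) ⟩
  bit O + (bit Lp + (bit Rp + (after O ws + after Lp ws + after Rp ws)))
    ≡⟨ interleave (bit O) (bit Lp) (bit Rp) (after O ws) (after Lp ws) (after Rp ws) ⟩
  (bit O + after O ws) + (bit Lp + after Lp ws) + (bit Rp + after Rp ws)
    ≡⟨ sym (cong₂ _+_ (cong₂ _+_ (count-∷ (p ∘ (O ∷_)) w ws) (count-∷ (p ∘ (Lp ∷_)) w ws))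
                      (count-∷ (p ∘ (Rp ∷_)) w ws)) ⟩
  after O (w ∷ ws) + after Lp (w ∷ ws) + after Rp (w ∷ ws) ∎
  where
  bit : Letter → ℕ
  bit a = if p (a ∷ w) then 1 else 0
  after : Letter → List Word → ℕ
  after a = count (p ∘ (a ∷_))
  interleave : ∀ a b c A B C → a + (b + (c + (A + B + C))) ≡ (a + A) + (b + B) + (c + C)
  interleave = solve-∀

endsAtZero : Maybe ℕ → Bool
endsAtZero = maybe′ (_≡ᵇ 0) false

isMotzkin≡endsAtZero : ∀ w → isMotzkin w ≡ endsAtZero (height 0 w)
isMotzkin≡endsAtZero w with height 0 w
... | just zero    = refl
... | just (suc _) = refl
... | nothing      = refl

isMotzkinFrom : ℕ → ℕ → Word → Bool
isMotzkinFrom h j w = endsAtZero (height h w) ∧ (numLeft w ≡ᵇ j)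

M : ℕ → ℕ → ℕ → ℕ
M n h j = count (isMotzkinFrom h j) (allWords n)

U-suc-suc : ∀ n j → U (suc n) (suc j) ≡ M n 1 j
U-suc-suc n j = begin
  U (suc n) (suc j)
    ≡⟨ count-concatMap-extend (isU (suc j)) (allWords n) ⟩
  count (isU (suc j) ∘ (O ∷_)) ws + count (isU (suc j) ∘ (Lp ∷_)) ws + count (isU (suc j) ∘ (Rp ∷_)) ws
    ≡⟨ cong₂ _+_ (cong₂ _+_ (count-false (λ w → ∧-zeroʳ (isMotzkin (O ∷ w))) ws)
                            (count-cong (λ w → cong (_∧ (numLeft w ≡ᵇ j)) (isMotzkin≡endsAtZero (Lp ∷ w))) ws))
                 (count-false (λ w → ∧-zeroʳ (isMotzkin (Rp ∷ w))) ws) ⟩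
  0 + M n 1 j + 0
    ≡⟨ +-identityʳ (M n 1 j) ⟩
  M n 1 j ∎
  where ws = allWords n

Mˡ : ℕ → ℕ → ℕ → ℕ
Mˡ m h zero    = 0
Mˡ m h (suc j) = M m (suc h) j

Mʳ : ℕ → ℕ → ℕ → ℕ
Mʳ m zero    j = 0
Mʳ m (suc h) j = M m h j

M-suc : ∀ m h j → M (suc m) h j ≡ M m h j + Mˡ m h j + Mʳ m h j
M-suc m h j = trans (count-concatMap-extend (isMotzkinFrom h j) ws)
                    (cong₂ _+_ (cong (M m h j +_) (afterLeft j)) (afterRight h))
  where
  ws = allWords m
  afterLeft : ∀ j → count (isMotzkinFrom h j ∘ (Lp ∷_)) ws ≡ Mˡ m h j
  afterLeft zero    = count-false (λ w → ∧-zeroʳ (endsAtZero (height (suc h) w))) ws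
  afterLeft (suc j) = refl
  afterRight : ∀ h → count (isMotzkinFrom h j ∘ (Rp ∷_)) ws ≡ Mʳ m h j
  afterRight zero    = count-false (λ _ → refl) ws
  afterRight (suc h) = refl

M-vanishes : ∀ m h j → m < j + j + h → M m h j ≡ 0
M-vanishes zero zero    zero    ()
M-vanishes zero zero    (suc j) _ = refl
M-vanishes zero (suc h) j       _ = refl
M-vanishes (suc m) h j m<2j+h = trans (M-suc m h j)
  (cong₂ _+_ (cong₂ _+_ (M-vanishes m h j (<-trans (n<1+n m) m<2j+h)) (afterLeft j m<2j+h))
             (afterRight h m<2j+h))
  where
  afterLeft : ∀ j → suc m < j + j + h → Mˡ m h j ≡ 0
  afterLeft zero    _ = refl
  afterLeft (suc j) lt = M-vanishes m (suc h) j (subst (m <_) (shift j h) (s≤s⁻¹ lt))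
    where
    shift : ∀ j h → j + suc j + h ≡ j + j + suc h
    shift = solve-∀
  afterRight : ∀ h → suc m < j + j + h → Mʳ m h j ≡ 0
  afterRight zero    _  = refl
  afterRight (suc h) lt = M-vanishes m h j (s≤s⁻¹ (subst (suc m <_) (+-suc (j + j) h) lt))

ballotDenom : ℕ → ℕ → ℕ → ℕ
ballotDenom z j h = z ! * j ! * (j + suc h) !

ballotDenom-nonZero : ∀ z j h → NonZero (ballotDenom z j h)
ballotDenom-nonZero z j h = m*n≢0 (z ! * j !) ((j + suc h) !) {{z !* j !≢0}} {{(j + suc h) !≢0}}

ballotDenom-sucᶻ : ∀ z j h → ballotDenom (suc z) j h ≡ suc z * ballotDenom z j h
ballotDenom-sucᶻ z j h = reassoc (suc z) (z !) (j !) ((j + suc h) !)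
  where
  reassoc : ∀ s a b c → s * a * b * c ≡ s * (a * b * c)
  reassoc = solve-∀

ballotDenom-sucʲ : ∀ z j h → ballotDenom z (suc j) h ≡ suc j * ballotDenom z j (suc h)
ballotDenom-sucʲ z j h rewrite +-suc j (suc h) = reassoc (z !) (suc j) (j !) ((suc (j + suc h)) !)
  where
  reassoc : ∀ a s b c → a * (s * b) * c ≡ s * (a * b * c)
  reassoc = solve-∀

ballotDenom-sucʰ : ∀ z j h → ballotDenom z j (suc h) ≡ suc (j + suc h) * ballotDenom z j h
ballotDenom-sucʰ z j h rewrite +-suc j (suc h) = reassoc (z !) (j !) (suc (j + suc h)) ((j + suc h) !)
  where
  reassoc : ∀ a b s c → a * b * (s * c) ≡ s * (a * b * c)
  reassoc = solve-∀

Ballot : ℕ → Set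
Ballot m = ∀ z j h → m ≡ z + (j + j) + h → M m h j * ballotDenom z j h ≡ suc h * m !

scale-* : ∀ x s d r → x * d ≡ r → x * (s * d) ≡ s * r
scale-* x s d r x*d≡r = trans (x∙yz≈y∙xz x s d) (cong (s *_) x*d≡r)

ballot-afterO : ∀ m → Ballot m → ∀ z j h → suc m ≡ z + (j + j) + h →
                M m h j * ballotDenom z j h ≡ z * (suc h * m !)
ballot-afterO m _ zero j h eq
  rewrite M-vanishes m h j (≤-reflexive eq) = refl
ballot-afterO m ih (suc z) j h eq
  rewrite ballotDenom-sucᶻ z j h = scale-* (M m h j) (suc z) _ _ (ih z j h (suc-injective eq))

ballot-afterLeft : ∀ m → Ballot m → ∀ z j h → suc m ≡ z + (j + j) + h →
                   Mˡ m h j * ballotDenom z j h ≡ j * (suc (suc h) * m !)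
ballot-afterLeft m _ z zero    h _ = refl
ballot-afterLeft m ih z (suc j) h eq
  rewrite ballotDenom-sucʲ z j h =
    scale-* (M m (suc h) j) (suc j) _ _ (ih z j (suc h) (suc-injective (trans eq (shift z j h))))
  where
  shift : ∀ z j h → z + (suc j + suc j) + h ≡ suc (z + (j + j) + suc h)
  shift = solve-∀

ballot-afterRight : ∀ m → Ballot m → ∀ z j h → suc m ≡ z + (j + j) + h →
                    Mʳ m h j * ballotDenom z j h ≡ h * (suc (j + h) * m !)
ballot-afterRight m _ z j zero    _ = refl
ballot-afterRight m ih z j (suc h) eq rewrite ballotDenom-sucʰ z j h = begin
  M m h j * (suc (j + suc h) * ballotDenom z j h) ≡⟨ scale-* (M m h j) (suc (j + suc h)) _ _ (ih z j h m≡) ⟩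
  suc (j + suc h) * (suc h * m !)                 ≡⟨ x∙yz≈y∙xz (suc (j + suc h)) (suc h) (m !) ⟩
  suc h * (suc (j + suc h) * m !)                 ∎
  where
  m≡ : m ≡ z + (j + j) + h
  m≡ = suc-injective (trans eq (+-suc (z + (j + j)) h))

ballot : ∀ m → Ballot m
ballot zero    zero    zero    zero    _  = refl
ballot (suc m) z j h eq = begin
  M (suc m) h j * d                                 ≡⟨ cong (_* d) (M-suc m h j) ⟩
  (M m h j + Mˡ m h j + Mʳ m h j) * d               ≡⟨ distrib (M m h j) (Mˡ m h j) (Mʳ m h j) d ⟩
  M m h j * d + Mˡ m h j * d + Mʳ m h j * d
    ≡⟨ cong₂ _+_ (cong₂ _+_ (ballot-afterO m (ballot m) z j h eq) (ballot-afterLeft m (ballot m) z j h eq))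
                 (ballot-afterRight m (ballot m) z j h eq) ⟩
  z * (suc h * m !) + j * (suc (suc h) * m !) + h * (suc (j + h) * m !) ≡⟨ collect z j h (m !) ⟩
  suc h * ((z + (j + j) + h) * m !)                 ≡⟨ cong (λ n → suc h * (n * m !)) (sym eq) ⟩
  suc h * suc m !                                   ∎
  where
  d = ballotDenom z j h
  distrib : ∀ a b c d → (a + b + c) * d ≡ a * d + b * d + c * d
  distrib = solve-∀
  collect : ∀ z j h f → z * ((1 + h) * f) + j * ((2 + h) * f) + h * ((1 + (j + h)) * f) ≡ (1 + h) * ((z + (j + j) + h) * f)
  collect = solve-∀

M-determined : ∀ {m h j j′} z z′ → m ≡ z + (j + j) + h → m ≡ z′ + (j′ + j′) + h →
               ballotDenom z j h ≡ ballotDenom z′ j′ h → M m h j ≡ M m h j′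
M-determined {m} {h} {j} {j′} z z′ eq eq′ d≡d′ =
  *-cancelʳ-≡ (M m h j) (M m h j′) (ballotDenom z j h) {{ballotDenom-nonZero z j h}} (begin
    M m h j * ballotDenom z j h   ≡⟨ ballot m z j h eq ⟩
    suc h * m !                   ≡⟨ sym (ballot m z′ j′ h eq′) ⟩
    M m h j′ * ballotDenom z′ j′ h ≡⟨ cong (M m h j′ *_) (sym d≡d′) ⟩
    M m h j′ * ballotDenom z j h  ∎)

proposition3p5 : ∀ (k : ℕ) → 1 < k → U (3 * k) (k ∸ 1) ≡ U (3 * k) (suc k)
proposition3p5 (suc zero) (s≤s ())
proposition3p5 (suc (suc k)) _ = begin
  U (suc n) (suc k)             ≡⟨ U-suc-suc n k ⟩
  M n 1 k                       ≡⟨ M-determined (4 + k) k (suc-injective (length₁ k)) (suc-injective (length₂ k)) denominators ⟩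
  M n 1 (2 + k)                 ≡⟨ sym (U-suc-suc n (2 + k)) ⟩
  U (suc n) (suc (suc (suc k))) ∎
  where
  n = 3 * (2 + k) ∸ 1
  length₁ : ∀ k → 3 * (2 + k) ≡ suc ((4 + k) + (k + k) + 1)
  length₁ = solve-∀
  length₂ : ∀ k → 3 * (2 + k) ≡ suc (k + ((2 + k) + (2 + k)) + 1)
  length₂ = solve-∀
  denominators : ballotDenom (4 + k) k 1 ≡ ballotDenom k (2 + k) 1
  denominators rewrite +-comm k 2 = xy∙z≈yz∙x ((4 + k) !) (k !) ((2 + k) !)
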